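{- Let $k\ge1$ and $N\ge s\ge1$ be integers. The sum of the levels of the $s$-th \textsc{min}-turns over all $k$-Dyck paths of length $(k+1)N$ equals $$\frac{sk}{kN+1}\binom{(k+1)N}{N}-\sum_{i=1}^{s}(s+1-i)\frac1{ki+1}\binom{(k+1)i}{i}\frac{k}{N-i+1}\binom{(k+1)(N-i)}{N-i}.$$
   Context: A $k$-Dyck path is a lattice path using up-steps $(1,k)$ and down-steps $(1,-1)$, starting at the origin, never going below the $x$-axis, and ending on the $x$-axis; a path with $N$ up-steps has length $(k+1)N$. The level of a point is its height. The $s$-th \textsc{min}-turn of a path is the point at which the path stands after its $s$-th up-step followed by the maximal run of down-steps that comes after it (i.e. the point where the $(s+1)$-st up-step starts, or the endpoint of the path if $s=N$). -}

module Defs where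

open import Data.Bool using (Bool; true; false; _∧_)
open import Data.Nat using (ℕ; zero; suc; _+_; _*_; _∸_; _≡ᵇ_)
open import Data.Nat.Combinatorics using (_C_)
open import Data.Nat.ListAction using (sum)
open import Data.List using (List; []; _∷_; map; filterᵇ; length; upTo; foldr; concatMap)
open import Data.Maybe using (Maybe; just; nothing)
open import Data.Integer using (+_)
open import Data.Rational using (ℚ; _/_; 0ℚ) renaming (_+_ to _+ℚ_; _-_ to _-ℚ_; _*_ to _*ℚ_)

-- Steps of a k-Dyck path: U = up-step (1,k), D = down-step (1,-1).
data Step : Set where
  U D : Step

words : ℕ → List (List Step)
words zero    = [] ∷ []
words (suc L) = concatMap (λ w → (U ∷ w) ∷ (D ∷ w) ∷ []) (words L)

walk : ℕ → ℕ → List Step → Maybe ℕ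
walk k h []           = just h
walk k h (U ∷ w)      = walk k (h + k) w
walk k zero (D ∷ w)    = nothing
walk k (suc h) (D ∷ w) = walk k h w

isDyckᵇ : ℕ → List Step → Bool
isDyckᵇ k w with walk k 0 w
... | just zero = true
... | _         = false

dyckPaths : ℕ → ℕ → List (List Step)
dyckPaths k N = filterᵇ (isDyckᵇ k) (words ((suc k) * N))

-- Level of the s-th min-turn (s ≥ 1): the height at the point where the
-- (s+1)-st up-step starts, or the final height if there are only s up-steps.
-- go h c w : current height h, c = number of up-steps already read.
minTurnGo : ℕ → ℕ → ℕ → ℕ → List Step → ℕ
minTurnGo k s h c []      = h
minTurnGo k s h c (U ∷ w) with c ≡ᵇ s
... | true  = h
... | false = minTurnGo k s (h + k) (suc c) w
minTurnGo k s h c (D ∷ w) = minTurnGo k s (h ∸ 1) c w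

minTurnLevel : ℕ → ℕ → List Step → ℕ
minTurnLevel k s w = minTurnGo k s 0 0 w

totalMinTurnLevel : ℕ → ℕ → ℕ → ℕ
totalMinTurnLevel k N s = sum (map (minTurnLevel k s) (dyckPaths k N))

ℕ→ℚ : ℕ → ℚ
ℕ→ℚ n = (+ n) / 1

sumℚ : List ℚ → ℚ
sumℚ = foldr _+ℚ_ 0ℚ

rhsTerm : ℕ → ℕ → ℕ → ℕ → ℚ
rhsTerm k N s i =
  ℕ→ℚ (suc s ∸ i)
  *ℚ ((+ ((suc k * i) C i)) / suc (k * i))
  *ℚ ((+ (k * ((suc k * (N ∸ i)) C (N ∸ i)))) / suc (N ∸ i))

rhs : ℕ → ℕ → ℕ → ℚ
rhs k N s =
  (+ (s * k * ((suc k * N) C N))) / suc (k * N)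
  -ℚ sumℚ (map (λ j → rhsTerm k N s (suc j)) (upTo s))

{-# OPTIONS --safe #-}
-- Write A m = C((k+1)m, m)/(km+1) and B m = k C((k+1)m, m)/(m+1). The level of the s-th
-- min-turn is ks minus the number of down-steps taken before it. Splitting paths at their
-- first step, the sum of the min-turn levels over the paths from height h with n up-steps
-- and the total length of the down-run after the i-th up-step satisfy recursions in h and
-- n, which are solved by ballot numbers: there are C(M, n) - k C(M, n-1) paths of length M
-- from height h, so A N paths from height 0 and B N paths from the heights below k, and the
-- down-run after the i-th up-step has total length Σ_{l<i} A (l+1) B (N-l-1). Summing over
-- i ≤ s yields the weights s+1-i of the formula.

module Submission where

open import Defs
open import Data.Nat using (ℕ; _≤_)
open import Data.Rational using (ℚ)
open import Relation.Binary.PropositionalEquality using (_≡_)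

open import Data.Bool using (Bool; true; false; if_then_else_)
open import Data.Empty using (⊥-elim)
open import Data.List using (List; []; _∷_; map; applyUpTo; concatMap; filterᵇ)
open import Data.List.Properties using (map-cong)
open import Data.Maybe using (Maybe; just; nothing)
open import Data.Nat using (zero; suc; _+_; _*_; _∸_; _<_; _≡ᵇ_; z≤n; s≤s)
open import Data.Nat.Combinatorics using (_C_; nC1≡n; nCk+nC[k+1]≡[n+1]C[k+1])
open import Data.Nat.ListAction using (sum)
open import Data.Nat.Properties
open import Algebra.Properties.CommutativeSemigroup +-commutativeSemigroup using () renaming (interchange to +-interchange)
open import Data.Nat.Tactic.RingSolver using (solve-∀)
open import Function using (_∘_)
open import Relation.Binary.PropositionalEquality using (refl; sym; trans; cong; cong₂; _≢_; module ≡-Reasoning)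
import Data.Integer as ℤ
import Data.Integer.Properties as ℤ
import Data.Rational as ℚ
import Data.Rational.Properties as ℚ
open import Data.Rational.Unnormalised as ℚᵘ using (mkℚᵘ; _≃_; *≡*)
import Data.Rational.Unnormalised.Properties as ℚᵘ
open ≡-Reasoning

∑< : ℕ → (ℕ → ℕ) → ℕ
∑< n f = sum (applyUpTo f n)

syntax ∑< n (λ i → e) = ∑[ i < n ] e

∑-cong : ∀ n {f g : ℕ → ℕ} → (∀ i → f i ≡ g i) → ∑< n f ≡ ∑< n g
∑-cong zero    f≗g = refl
∑-cong (suc n) f≗g = cong₂ _+_ (f≗g 0) (∑-cong n (f≗g ∘ suc))

∑-+ : ∀ n (f g : ℕ → ℕ) → ∑[ i < n ] (f i + g i) ≡ ∑< n f + ∑< n g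
∑-+ zero    f g = refl
∑-+ (suc n) f g = trans (cong (f 0 + g 0 +_) (∑-+ n (f ∘ suc) (g ∘ suc)))
                        (+-interchange (f 0) (g 0) (∑< n (f ∘ suc)) (∑< n (g ∘ suc)))

∑-const : ∀ n c → ∑[ i < n ] c ≡ n * c
∑-const zero    c = refl
∑-const (suc n) c = cong (c +_) (∑-const n c)

∑-triangle : ∀ j (f : ℕ → ℕ) → ∑[ i < suc j ] ∑< i f ≡ ∑[ l < j ] ((j ∸ l) * f l)
∑-triangle zero    f = refl
∑-triangle (suc j) f = begin
  ∑[ i < suc j ] (f 0 + ∑< i (f ∘ suc))
    ≡⟨ ∑-+ (suc j) (λ _ → f 0) (λ i → ∑< i (f ∘ suc)) ⟩
  ∑[ i < suc j ] f 0 + ∑[ i < suc j ] ∑< i (f ∘ suc)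
    ≡⟨ cong₂ _+_ (∑-const (suc j) (f 0)) (∑-triangle j (f ∘ suc)) ⟩
  suc j * f 0 + ∑[ l < j ] ((j ∸ l) * f (suc l))
    ∎

[1+m]*nC[1+m]+m*nCm≡n*nCm : ∀ n m → suc m * (n C suc m) + m * (n C m) ≡ n * (n C m)
[1+m]*nC[1+m]+m*nCm≡n*nCm zero    zero    = refl
[1+m]*nC[1+m]+m*nCm≡n*nCm zero    (suc m) = cong₂ _+_ (*-zeroʳ (suc (suc m))) (*-zeroʳ (suc m))
[1+m]*nC[1+m]+m*nCm≡n*nCm (suc n) zero    = begin
  1 * (suc n C 1) + 0  ≡⟨ cong (λ x → 1 * x + 0) (nC1≡n (suc n)) ⟩
  1 * suc n + 0        ≡⟨ units n ⟩
  suc n * 1            ∎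
  where units : ∀ n → 1 * suc n + 0 ≡ suc n * 1
        units = solve-∀
[1+m]*nC[1+m]+m*nCm≡n*nCm (suc n) (suc m) = begin
  suc (suc m) * (suc n C suc (suc m)) + suc m * (suc n C suc m)
    ≡⟨ cong₂ (λ x y → suc (suc m) * x + suc m * y)
             (sym (nCk+nC[k+1]≡[n+1]C[k+1] n (suc m))) (sym (nCk+nC[k+1]≡[n+1]C[k+1] n m)) ⟩
  suc (suc m) * (b + c) + suc m * (a + b)
    ≡⟨ regroup a b c m ⟩
  (suc (suc m) * c + suc m * b) + (suc m * b + m * a) + (b + a)
    ≡⟨ cong₂ (λ x y → x + y + (b + a))
             ([1+m]*nC[1+m]+m*nCm≡n*nCm n (suc m)) ([1+m]*nC[1+m]+m*nCm≡n*nCm n m) ⟩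
  n * b + n * a + (b + a)
    ≡⟨ collect a b n ⟩
  suc n * (a + b)
    ≡⟨ cong (suc n *_) (nCk+nC[k+1]≡[n+1]C[k+1] n m) ⟩
  suc n * (suc n C suc m)
    ∎
  where
    a b c : ℕ
    a = n C m
    b = n C suc m
    c = n C suc (suc m)
    regroup : ∀ a b c m → suc (suc m) * (b + c) + suc m * (a + b)
                        ≡ (suc (suc m) * c + suc m * b) + (suc m * b + m * a) + (b + a)
    regroup = solve-∀
    collect : ∀ a b n → n * b + n * a + (b + a) ≡ suc n * (a + b)
    collect = solve-∀

nC[1+m]≡k*nCm : ∀ k {n} m → n ≡ k * suc m + m → n C suc m ≡ k * (n C m)
nC[1+m]≡k*nCm k {n} m n≡ = *-cancelˡ-≡ _ _ (suc m) (+-cancelʳ-≡ (m * (n C m)) _ _ (begin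
  suc m * (n C suc m) + m * (n C m)   ≡⟨ [1+m]*nC[1+m]+m*nCm≡n*nCm n m ⟩
  n * (n C m)                         ≡⟨ cong (_* (n C m)) n≡ ⟩
  (k * suc m + m) * (n C m)           ≡⟨ distribute k m (n C m) ⟩
  suc m * (k * (n C m)) + m * (n C m) ∎))
  where distribute : ∀ k m c → (k * suc m + m) * c ≡ suc m * (k * c) + m * c
        distribute = solve-∀

toℚᵘ-ℕ→ℚ : ∀ a → ℚ.toℚᵘ (ℕ→ℚ a) ≃ mkℚᵘ (ℤ.+ a) 0
toℚᵘ-ℕ→ℚ a = ℚ.toℚᵘ-fromℚᵘ (mkℚᵘ (ℤ.+ a) 0)

ℕ→ℚ-+ : ∀ a b → ℕ→ℚ (a + b) ≡ ℕ→ℚ a ℚ.+ ℕ→ℚ b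
ℕ→ℚ-+ a b = ℚ.toℚᵘ-injective (begin≃
  ℚ.toℚᵘ (ℕ→ℚ (a + b))                  ≈⟨ toℚᵘ-ℕ→ℚ (a + b) ⟩
  mkℚᵘ (ℤ.+ (a + b)) 0                     ≈⟨ *≡* (cong (ℤ._* ℤ.+ 1) pos-+) ⟩
  mkℚᵘ (ℤ.+ a) 0 ℚᵘ.+ mkℚᵘ (ℤ.+ b) 0         ≈⟨ ℚᵘ.+-cong (toℚᵘ-ℕ→ℚ a) (toℚᵘ-ℕ→ℚ b) ⟨
  ℚ.toℚᵘ (ℕ→ℚ a) ℚᵘ.+ ℚ.toℚᵘ (ℕ→ℚ b)    ≈⟨ ℚ.toℚᵘ-homo-+ (ℕ→ℚ a) (ℕ→ℚ b) ⟨
  ℚ.toℚᵘ (ℕ→ℚ a ℚ.+ ℕ→ℚ b)              ∎≃)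
  where
    open ℚᵘ.≃-Reasoning renaming (begin_ to begin≃_; _∎ to _∎≃)
    pos-+ : ℤ.+ (a + b) ≡ ℤ.+ a ℤ.* ℤ.+ 1 ℤ.+ ℤ.+ b ℤ.* ℤ.+ 1
    pos-+ = trans (ℤ.pos-+ a b) (sym (cong₂ ℤ._+_ (ℤ.*-identityʳ (ℤ.+ a)) (ℤ.*-identityʳ (ℤ.+ b))))

ℕ→ℚ-* : ∀ a b → ℕ→ℚ (a * b) ≡ ℕ→ℚ a ℚ.* ℕ→ℚ b
ℕ→ℚ-* a b = ℚ.toℚᵘ-injective (begin≃
  ℚ.toℚᵘ (ℕ→ℚ (a * b))                  ≈⟨ toℚᵘ-ℕ→ℚ (a * b) ⟩
  mkℚᵘ (ℤ.+ (a * b)) 0                     ≈⟨ *≡* (cong (ℤ._* ℤ.+ 1) (ℤ.pos-* a b)) ⟩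
  mkℚᵘ (ℤ.+ a) 0 ℚᵘ.* mkℚᵘ (ℤ.+ b) 0         ≈⟨ ℚᵘ.*-cong (toℚᵘ-ℕ→ℚ a) (toℚᵘ-ℕ→ℚ b) ⟨
  ℚ.toℚᵘ (ℕ→ℚ a) ℚᵘ.* ℚ.toℚᵘ (ℕ→ℚ b)    ≈⟨ ℚ.toℚᵘ-homo-* (ℕ→ℚ a) (ℕ→ℚ b) ⟨
  ℚ.toℚᵘ (ℕ→ℚ a ℚ.* ℕ→ℚ b)              ∎≃)
  where open ℚᵘ.≃-Reasoning renaming (begin_ to begin≃_; _∎ to _∎≃)

/-suc≡ℕ→ℚ : ∀ a {b} q → a * suc q ≡ b → (ℤ.+ b) ℚ./ suc q ≡ ℕ→ℚ a
/-suc≡ℕ→ℚ a {b} q a*q≡b = ℚ.fromℚᵘ-cong {mkℚᵘ (ℤ.+ b) q} {mkℚᵘ (ℤ.+ a) 0} (*≡* (begin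
  ℤ.+ b ℤ.* ℤ.+ 1       ≡⟨ ℤ.*-identityʳ (ℤ.+ b) ⟩
  ℤ.+ b               ≡⟨ cong ℤ.+_ a*q≡b ⟨
  ℤ.+ (a * suc q)     ≡⟨ ℤ.pos-* a (suc q) ⟩
  ℤ.+ a ℤ.* ℤ.+ suc q   ∎))

ℕ→ℚ-difference : ∀ x z {y} → x + z ≡ y → ℕ→ℚ x ≡ ℕ→ℚ y ℚ.- ℕ→ℚ z
ℕ→ℚ-difference x z {y} x+z≡y = sym (begin
  ℕ→ℚ y ℚ.- ℕ→ℚ z                      ≡⟨ cong (λ t → ℕ→ℚ t ℚ.- ℕ→ℚ z) x+z≡y ⟨
  ℕ→ℚ (x + z) ℚ.- ℕ→ℚ z                ≡⟨ cong (ℚ._- ℕ→ℚ z) (ℕ→ℚ-+ x z) ⟩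
  (ℕ→ℚ x ℚ.+ ℕ→ℚ z) ℚ.- ℕ→ℚ z          ≡⟨ ℚ.+-assoc (ℕ→ℚ x) (ℕ→ℚ z) (ℚ.- ℕ→ℚ z) ⟩
  ℕ→ℚ x ℚ.+ (ℕ→ℚ z ℚ.- ℕ→ℚ z)          ≡⟨ cong (ℕ→ℚ x ℚ.+_) (ℚ.+-inverseʳ (ℕ→ℚ z)) ⟩
  ℕ→ℚ x ℚ.+ ℚ.0ℚ                       ≡⟨ ℚ.+-identityʳ (ℕ→ℚ x) ⟩
  ℕ→ℚ x                                ∎)

sumℚ-map-applyUpTo : ∀ {G : ℕ → ℚ} {g : ℕ → ℕ} → (∀ i → G i ≡ ℕ→ℚ (g i)) →
  ∀ n f → sumℚ (map G (applyUpTo f n)) ≡ ℕ→ℚ (∑[ i < n ] g (f i))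
sumℚ-map-applyUpTo G≡g zero    f = refl
sumℚ-map-applyUpTo {G} {g} G≡g (suc n) f =
  trans (cong₂ ℚ._+_ (G≡g (f 0)) (sumℚ-map-applyUpTo {G} {g} G≡g n (f ∘ suc)))
        (sym (ℕ→ℚ-+ (g (f 0)) (∑[ i < n ] g (f (suc i)))))

isZeroᵇ : Maybe ℕ → Bool
isZeroᵇ (just zero) = true
isZeroᵇ _           = false

isDyckᵇ≡isZeroᵇ : ∀ k w → isDyckᵇ k w ≡ isZeroᵇ (walk k 0 w)
isDyckᵇ≡isZeroᵇ k w with walk k 0 w
... | just zero    = refl
... | just (suc _) = refl
... | nothing      = refl

sum-map-filterᵇ : ∀ {A : Set} (p : A → Bool) (f : A → ℕ) xs →
  sum (map f (filterᵇ p xs)) ≡ sum (map (λ x → if p x then f x else 0) xs)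
sum-map-filterᵇ p f []       = refl
sum-map-filterᵇ p f (x ∷ xs) with p x
... | true  = cong (f x +_) (sum-map-filterᵇ p f xs)
... | false = sum-map-filterᵇ p f xs

sum-map-zero : ∀ {A : Set} (xs : List A) → sum (map (λ _ → 0) xs) ≡ 0
sum-map-zero []       = refl
sum-map-zero (_ ∷ xs) = sum-map-zero xs

sum-map-words-suc : ∀ L (F : List Step → ℕ) →
  sum (map F (words (suc L))) ≡ sum (map (F ∘ (U ∷_)) (words L)) + sum (map (F ∘ (D ∷_)) (words L))
sum-map-words-suc L F = split (words L)
  where
    split : ∀ ws → sum (map F (concatMap (λ w → (U ∷ w) ∷ (D ∷ w) ∷ []) ws))
                 ≡ sum (map (F ∘ (U ∷_)) ws) + sum (map (F ∘ (D ∷_)) ws)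
    split []       = refl
    split (w ∷ ws) = trans (cong (λ x → F (U ∷ w) + (F (D ∷ w) + x)) (split ws))
                           (trans (sym (+-assoc (F (U ∷ w)) (F (D ∷ w)) (u + d)))
                                  (+-interchange (F (U ∷ w)) (F (D ∷ w)) u d))
      where
        u d : ℕ
        u = sum (map (F ∘ (U ∷_)) ws)
        d = sum (map (F ∘ (D ∷_)) ws)

minTurnGo-U-stop : ∀ k {s c} h w → c ≡ s → minTurnGo k s h c (U ∷ w) ≡ h
minTurnGo-U-stop k {s} h w refl with s ≡ᵇ s | ≡⇒≡ᵇ s s refl
... | true  | _  = refl
... | false | ()

minTurnGo-U-pass : ∀ k {s c} h w → c ≢ s → minTurnGo k s h c (U ∷ w) ≡ minTurnGo k s (h + k) (suc c) w
minTurnGo-U-pass k {s} {c} h w c≢s with c ≡ᵇ s | ≡ᵇ⇒≡ c s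
... | true  | c≡s = ⊥-elim (c≢s (c≡s _))
... | false | _   = refl

[1+j]+c≡s⇒c≢s : ∀ j {c s} → suc j + c ≡ s → c ≢ s
[1+j]+c≡s⇒c≢s j {c} eq = <⇒≢ (≤-trans (s≤s (m≤n+m c j)) (≤-reflexive eq))

module _ (k : ℕ) where

  -- The number of k-Dyck path segments from height h down to the x-axis with n up-steps.
  dyckFrom : ℕ → ℕ → ℕ
  dyckFrom h       zero    = 1
  dyckFrom zero    (suc n) = dyckFrom k n
  dyckFrom (suc h) (suc n) = dyckFrom h (suc n) + dyckFrom (suc h + k) n

  dyckBelow : ℕ → ℕ → ℕ
  dyckBelow zero    n = 0
  dyckBelow (suc h) n = dyckBelow h n + dyckFrom h n

  length-U : ∀ n h {L} → suc L ≡ suc n * suc k + h → L ≡ n * suc k + (h + k)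
  length-U n h eq = suc-injective (trans eq (rotate k n h))
    where rotate : ∀ k n h → suc n * suc k + h ≡ suc (n * suc k + (h + k))
          rotate = solve-∀

  length-D : ∀ n h {L} → suc L ≡ n * suc k + suc h → L ≡ n * suc k + h
  length-D n h eq = suc-injective (trans eq (+-suc _ h))

  length-C-ratio : ∀ n {M} → M ≡ suc n * suc k + k → M C suc (suc n) ≡ k * (M C suc n)
  length-C-ratio n M≡ = nC[1+m]≡k*nCm k (suc n) (trans M≡ (rotate n k))
    where rotate : ∀ n k → suc n * suc k + k ≡ k * suc (suc n) + suc n
          rotate = solve-∀

  dyckFrom-one : ∀ h → dyckFrom h 1 ≡ suc h
  dyckFrom-one zero    = refl
  dyckFrom-one (suc h) = trans (cong (_+ 1) (dyckFrom-one h)) (+-comm (suc h) 1)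

  -- The ballot formula dyckFrom h (n + 1) = C(M, n + 1) - k C(M, n) for the path length M,
  -- stated without subtraction.
  dyckFrom-ballot : ∀ n h {M} → M ≡ suc n * suc k + h → dyckFrom h (suc n) + k * (M C n) ≡ M C suc n
  dyckFrom-ballot zero h {M} M≡ = begin
    dyckFrom h 1 + k * 1  ≡⟨ cong (_+ k * 1) (dyckFrom-one h) ⟩
    suc h + k * 1         ≡⟨ length-one k h ⟩
    suc k + 0 + h         ≡⟨ sym M≡ ⟩
    M                     ≡⟨ sym (nC1≡n M) ⟩
    M C 1                 ∎
    where length-one : ∀ k h → suc h + k * 1 ≡ suc k + 0 + h
          length-one = solve-∀
  dyckFrom-ballot (suc n) h {zero} ()
  dyckFrom-ballot (suc n) zero {suc M} M≡ = begin
    d + k * (suc M C suc n)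
      ≡⟨ cong (λ x → d + k * x) (sym (nCk+nC[k+1]≡[n+1]C[k+1] M n)) ⟩
    d + k * (M C n + M C suc n)
      ≡⟨ trans (cong (d +_) (*-distribˡ-+ k _ _)) (sym (+-assoc d _ _)) ⟩
    (d + k * (M C n)) + k * (M C suc n)
      ≡⟨ cong₂ _+_ (dyckFrom-ballot n k M≡′) (sym (length-C-ratio n M≡′)) ⟩
    M C suc n + M C suc (suc n)
      ≡⟨ nCk+nC[k+1]≡[n+1]C[k+1] M (suc n) ⟩
    suc M C suc (suc n)
      ∎
    where
      d : ℕ
      d = dyckFrom k (suc n)
      M≡′ : M ≡ suc n * suc k + k
      M≡′ = length-U (suc n) 0 M≡
  dyckFrom-ballot (suc n) (suc h) {suc M} M≡ = begin
    d₁ + d₂ + k * (suc M C suc n)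
      ≡⟨ cong (λ x → d₁ + d₂ + k * x) (sym (nCk+nC[k+1]≡[n+1]C[k+1] M n)) ⟩
    d₁ + d₂ + k * (M C n + M C suc n)
      ≡⟨ regroup k d₁ d₂ (M C n) (M C suc n) ⟩
    (d₁ + k * (M C suc n)) + (d₂ + k * (M C n))
      ≡⟨ cong₂ _+_ (dyckFrom-ballot (suc n) h (length-D (suc (suc n)) h M≡))
                   (dyckFrom-ballot n (suc h + k) (length-U (suc n) (suc h) M≡)) ⟩
    M C suc (suc n) + M C suc n
      ≡⟨ trans (+-comm (M C suc (suc n)) _) (nCk+nC[k+1]≡[n+1]C[k+1] M (suc n)) ⟩
    suc M C suc (suc n)
      ∎
    where
      d₁ d₂ : ℕ
      d₁ = dyckFrom h (suc (suc n))
      d₂ = dyckFrom (suc h + k) (suc n)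
      regroup : ∀ k x y a b → x + y + k * (a + b) ≡ (x + k * b) + (y + k * a)
      regroup = solve-∀

  suc-*-dyckFrom-zero : ∀ n → suc n * dyckFrom 0 (suc n) ≡ (suc n * suc k) C n
  suc-*-dyckFrom-zero n = +-cancelʳ-≡ (n * a + k * (suc n * a)) _ _ (begin
    suc n * d + (n * a + k * (suc n * a))  ≡⟨ factor k n d a ⟩
    suc n * (d + k * a) + n * a            ≡⟨ cong (λ x → suc n * x + n * a) (dyckFrom-ballot n 0 (sym (+-identityʳ L))) ⟩
    suc n * (L C suc n) + n * a            ≡⟨ [1+m]*nC[1+m]+m*nCm≡n*nCm L n ⟩
    L * a                                  ≡⟨ expand k n a ⟩
    a + (n * a + k * (suc n * a))          ∎)
    where
      L a d : ℕ
      L = suc n * suc k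
      a = L C n
      d = dyckFrom 0 (suc n)
      factor : ∀ k n d a → suc n * d + (n * a + k * (suc n * a)) ≡ suc n * (d + k * a) + n * a
      factor = solve-∀
      expand : ∀ k n a → suc n * suc k * a ≡ a + (n * a + k * (suc n * a))
      expand = solve-∀

  dyckFrom-zero-closed : ∀ m → dyckFrom 0 m * suc (k * m) ≡ (suc k * m) C m
  dyckFrom-zero-closed zero    = trans (+-identityʳ _) (cong suc (*-zeroʳ k))
  dyckFrom-zero-closed (suc n) = begin
    d * suc (k * suc n)      ≡⟨ unfold k n d ⟩
    d + k * (suc n * d)      ≡⟨ cong (λ x → d + k * x) (suc-*-dyckFrom-zero n) ⟩
    d + k * (L C n)          ≡⟨ dyckFrom-ballot n 0 (sym (+-identityʳ L)) ⟩
    L C suc n                ≡⟨ cong (_C suc n) (*-comm (suc n) (suc k)) ⟩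
    (suc k * suc n) C suc n  ∎
    where
      L d : ℕ
      L = suc n * suc k
      d = dyckFrom 0 (suc n)
      unfold : ∀ k n d → d * suc (k * suc n) ≡ d + k * (suc n * d)
      unfold = solve-∀

  dyckBelow-zero : ∀ h → dyckBelow h 0 ≡ h
  dyckBelow-zero zero    = refl
  dyckBelow-zero (suc h) = trans (cong (_+ 1) (dyckBelow-zero h)) (+-comm h 1)

  dyckBelow-hockey : ∀ n h {M} → M ≡ suc n * suc k + h →
    dyckBelow h (suc n) + k * (M C suc n) + (suc n * suc k) C suc (suc n)
      ≡ M C suc (suc n) + k * ((suc n * suc k) C suc n)
  dyckBelow-hockey n zero M≡ rewrite trans M≡ (+-identityʳ (suc n * suc k)) =
    +-comm (k * ((suc n * suc k) C suc n)) _
  dyckBelow-hockey n (suc h) {zero} ()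
  dyckBelow-hockey n (suc h) {suc M} M≡ = begin
    e + d + k * (suc M C suc n) + c₂
      ≡⟨ cong (λ x → e + d + k * x + c₂) (sym (nCk+nC[k+1]≡[n+1]C[k+1] M n)) ⟩
    e + d + k * (M C n + M C suc n) + c₂
      ≡⟨ regroup k e d c₂ (M C n) (M C suc n) ⟩
    (e + k * (M C suc n) + c₂) + (d + k * (M C n))
      ≡⟨ cong₂ _+_ (dyckBelow-hockey n h M≡ᴰ) (dyckFrom-ballot n h M≡ᴰ) ⟩
    (M C suc (suc n) + k * c₁) + M C suc n
      ≡⟨ regroup′ (M C suc (suc n)) (k * c₁) (M C suc n) ⟩
    (M C suc n + M C suc (suc n)) + k * c₁
      ≡⟨ cong (_+ k * c₁) (nCk+nC[k+1]≡[n+1]C[k+1] M (suc n)) ⟩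
    suc M C suc (suc n) + k * c₁
      ∎
    where
      e d c₁ c₂ : ℕ
      e = dyckBelow h (suc n)
      d = dyckFrom h (suc n)
      c₁ = (suc n * suc k) C suc n
      c₂ = (suc n * suc k) C suc (suc n)
      M≡ᴰ : M ≡ suc n * suc k + h
      M≡ᴰ = length-D (suc n) h M≡
      regroup : ∀ k e d c a b → e + d + k * (a + b) + c ≡ (e + k * b + c) + (d + k * a)
      regroup = solve-∀
      regroup′ : ∀ x y z → (x + y) + z ≡ (z + x) + y
      regroup′ = solve-∀

  dyckBelow-k+C≡k*C : ∀ n → dyckBelow k (suc n) + (suc n * suc k) C suc (suc n) ≡ k * ((suc n * suc k) C suc n)
  dyckBelow-k+C≡k*C n = +-cancelˡ-≡ (k * (M C suc n)) _ _ (begin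
    k * (M C suc n) + (b + c₂)      ≡⟨ swap (k * (M C suc n)) b c₂ ⟩
    b + k * (M C suc n) + c₂        ≡⟨ dyckBelow-hockey n k refl ⟩
    M C suc (suc n) + k * c₁        ≡⟨ cong (_+ k * c₁) (length-C-ratio n refl) ⟩
    k * (M C suc n) + k * c₁        ∎)
    where
      M b c₁ c₂ : ℕ
      M = suc n * suc k + k
      b = dyckBelow k (suc n)
      c₁ = (suc n * suc k) C suc n
      c₂ = (suc n * suc k) C suc (suc n)
      swap : ∀ x y z → x + (y + z) ≡ y + x + z
      swap = solve-∀

  dyckBelow-k-closed : ∀ m → dyckBelow k m * suc m ≡ k * ((suc k * m) C m)
  dyckBelow-k-closed zero    = cong (_* 1) (dyckBelow-zero k)
  dyckBelow-k-closed (suc n) = begin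
    b * suc (suc n)                                 ≡⟨ +-cancelʳ-≡ X _ _ cancellable ⟩
    k * (L C suc n)                                 ≡⟨ cong (λ x → k * (x C suc n)) (*-comm (suc n) (suc k)) ⟩
    k * ((suc k * suc n) C suc n)                   ∎
    where
      L b c₁ c₂ X : ℕ
      L = suc n * suc k
      b = dyckBelow k (suc n)
      c₁ = L C suc n
      c₂ = L C suc (suc n)
      X = suc (suc n) * c₂ + suc n * c₁
      factor : ∀ n b c₁ c₂ → b * suc (suc n) + (suc (suc n) * c₂ + suc n * c₁) ≡ suc (suc n) * (b + c₂) + suc n * c₁
      factor = solve-∀
      expand : ∀ k n c₁ → suc (suc n) * (k * c₁) + suc n * c₁ ≡ k * c₁ + suc n * suc k * c₁
      expand = solve-∀
      cancellable : b * suc (suc n) + X ≡ k * c₁ + X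
      cancellable = begin
        b * suc (suc n) + X                    ≡⟨ factor n b c₁ c₂ ⟩
        suc (suc n) * (b + c₂) + suc n * c₁    ≡⟨ cong (λ x → suc (suc n) * x + suc n * c₁) (dyckBelow-k+C≡k*C n) ⟩
        suc (suc n) * (k * c₁) + suc n * c₁    ≡⟨ expand k n c₁ ⟩
        k * c₁ + L * c₁                        ≡⟨ cong (k * c₁ +_) (sym ([1+m]*nC[1+m]+m*nCm≡n*nCm L (suc n))) ⟩
        k * c₁ + X                             ∎

  dyckBelow-shift : ∀ h n → dyckBelow (suc h + k) n ≡ dyckBelow k n + dyckFrom h (suc n)
  dyckBelow-shift zero    n = refl
  dyckBelow-shift (suc h) n =
    trans (cong (_+ dyckFrom (suc h + k) n) (dyckBelow-shift h n)) (+-assoc (dyckBelow k n) _ _)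

  -- For i ≤ n: the number of down-steps directly after the i-th up-step (the initial
  -- descent for i = 0), summed over the paths counted by dyckFrom h n.
  downRun : ℕ → ℕ → ℕ → ℕ
  downRun i h n = ∑[ l < i ] (dyckFrom h (suc l) * dyckBelow k (n ∸ suc l)) + dyckBelow h n

  downsBefore : ℕ → ℕ → ℕ → ℕ
  downsBefore j h n = ∑[ i < suc j ] downRun i h n

  downRun-suc-zero : ∀ i n → downRun (suc i) 0 (suc n) ≡ downRun i k n
  downRun-suc-zero i n = rotate (dyckBelow k n) (∑[ l < i ] (dyckFrom k (suc l) * dyckBelow k (n ∸ suc l)))
    where rotate : ∀ b r → 1 * b + r + 0 ≡ r + b
          rotate = solve-∀

  downRun-suc-suc : ∀ i h n →
    downRun (suc i) (suc h) (suc n) ≡ downRun (suc i) h (suc n) + downRun i (suc h + k) n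
  downRun-suc-suc i h n = begin
    ∑[ l < suc i ] ((dyckFrom h (suc l) + dyckFrom h′ l) * b (n ∸ l)) + (e + d)
      ≡⟨ cong (_+ (e + d))
              (trans (∑-cong (suc i) (λ l → *-distribʳ-+ (b (n ∸ l)) (dyckFrom h (suc l)) (dyckFrom h′ l)))
                     (∑-+ (suc i) (λ l → dyckFrom h (suc l) * b (n ∸ l)) (λ l → dyckFrom h′ l * b (n ∸ l)))) ⟩
    (r + (1 * b n + r′)) + (e + d)
      ≡⟨ regroup r (b n) r′ e d ⟩
    (r + e) + (r′ + (b n + d))
      ≡⟨ cong (λ x → (r + e) + (r′ + x)) (sym (dyckBelow-shift h n)) ⟩
    (r + e) + (r′ + dyckBelow h′ n)
      ∎
    where
      h′ e d r r′ : ℕ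
      b : ℕ → ℕ
      h′ = suc h + k
      b = dyckBelow k
      e = dyckBelow h (suc n)
      d = dyckFrom h (suc n)
      r = ∑[ l < suc i ] (dyckFrom h (suc l) * b (n ∸ l))
      r′ = ∑[ l < i ] (dyckFrom h′ (suc l) * b (n ∸ suc l))
      regroup : ∀ r b r′ e d → (r + (1 * b + r′)) + (e + d) ≡ (r + e) + (r′ + (b + d))
      regroup = solve-∀

  downsBefore-zero-suc : ∀ h n → downsBefore 0 (suc h) n ≡ downsBefore 0 h n + dyckFrom h n
  downsBefore-zero-suc h n = shift (dyckBelow h n) (dyckFrom h n)
    where shift : ∀ e d → e + d + 0 ≡ e + 0 + d
          shift = solve-∀

  downsBefore-suc-zero : ∀ j n → downsBefore (suc j) 0 (suc n) ≡ downsBefore j k n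
  downsBefore-suc-zero j n = ∑-cong (suc j) (λ i → downRun-suc-zero i n)

  downsBefore-suc-suc : ∀ j h n → downsBefore (suc j) (suc h) (suc n)
    ≡ downsBefore (suc j) h (suc n) + downsBefore j (suc h + k) n + dyckFrom h (suc n)
  downsBefore-suc-suc j h n = begin
    (e + d) + ∑[ i < suc j ] downRun (suc i) (suc h) (suc n)
      ≡⟨ cong ((e + d) +_) (trans (∑-cong (suc j) (λ i → downRun-suc-suc i h n))
                                  (∑-+ (suc j) (λ i → downRun (suc i) h (suc n)) (λ i → downRun i (suc h + k) n))) ⟩
    (e + d) + (∑[ i < suc j ] downRun (suc i) h (suc n) + downsBefore j (suc h + k) n)
      ≡⟨ regroup e d _ _ ⟩
    (e + ∑[ i < suc j ] downRun (suc i) h (suc n)) + downsBefore j (suc h + k) n + d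
      ∎
    where
      e d : ℕ
      e = dyckBelow h (suc n)
      d = dyckFrom h (suc n)
      regroup : ∀ e d x y → (e + d) + (x + y) ≡ (e + x) + y + d
      regroup = solve-∀

  returnsᵇ : ℕ → List Step → Bool
  returnsᵇ h w = isZeroᵇ (walk k h w)

  pathSum : ℕ → ℕ → (List Step → ℕ) → ℕ
  pathSum h L f = sum (map (λ w → if returnsᵇ h w then f w else 0) (words L))

  pathSum-cong : ∀ h L {f g} → (∀ w → f w ≡ g w) → pathSum h L f ≡ pathSum h L g
  pathSum-cong h L f≗g = cong sum (map-cong (λ w → cong (λ x → if returnsᵇ h w then x else 0) (f≗g w)) (words L))

  pathSum-zero-suc : ∀ L f → pathSum 0 (suc L) f ≡ pathSum k L (f ∘ (U ∷_))
  pathSum-zero-suc L f = trans (sum-map-words-suc L _)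
    (trans (cong (pathSum k L (f ∘ (U ∷_)) +_) (sum-map-zero (words L))) (+-identityʳ _))

  pathSum-suc-suc : ∀ h L f →
    pathSum (suc h) (suc L) f ≡ pathSum (suc h + k) L (f ∘ (U ∷_)) + pathSum h L (f ∘ (D ∷_))
  pathSum-suc-suc h L f = sum-map-words-suc L _

  pathSum-vanish : ∀ L h f → L < h → pathSum h L f ≡ 0
  pathSum-vanish zero    (suc h) f _          = refl
  pathSum-vanish (suc L) (suc h) f (s≤s L<h) = trans (pathSum-suc-suc h L f) (cong₂ _+_
    (pathSum-vanish L (suc h + k) _ (≤-trans (m≤n⇒m≤1+n L<h) (m≤m+n (suc h) k)))
    (pathSum-vanish L h _ L<h))

  pathSum-const : ∀ a n h {L} → L ≡ n * suc k + h → pathSum h L (λ _ → a) ≡ a * dyckFrom h n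
  pathSum-const a zero    zero    refl = trans (+-identityʳ a) (sym (*-identityʳ a))
  pathSum-const a zero    (suc h) refl = trans (pathSum-suc-suc h h _)
    (trans (cong (_+ pathSum h h (λ _ → a)) (pathSum-vanish h (suc h + k) _ (s≤s (m≤m+n h k))))
           (pathSum-const a zero h refl))
  pathSum-const a (suc n) h       {zero}  ()
  pathSum-const a (suc n) zero    {suc L} eq = trans (pathSum-zero-suc L _) (pathSum-const a n k (length-U n 0 eq))
  pathSum-const a (suc n) (suc h) {suc L} eq = begin
    pathSum (suc h) (suc L) (λ _ → a)
      ≡⟨ pathSum-suc-suc h L _ ⟩
    pathSum (suc h + k) L (λ _ → a) + pathSum h L (λ _ → a)
      ≡⟨ cong₂ _+_ (pathSum-const a n (suc h + k) (length-U n (suc h) eq))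
                   (pathSum-const a (suc n) h (length-D (suc n) h eq)) ⟩
    a * dyckFrom (suc h + k) n + a * dyckFrom h (suc n)
      ≡⟨ trans (sym (*-distribˡ-+ a _ _)) (cong (a *_) (+-comm (dyckFrom (suc h + k) n) _)) ⟩
    a * dyckFrom (suc h) (suc n)
      ∎

  pathSum-minTurnGo : ∀ s n h {L c j} → L ≡ n * suc k + h → j + c ≡ s → j ≤ n →
    pathSum h L (minTurnGo k s h c) + downsBefore j h n ≡ (h + k * j) * dyckFrom h n
  pathSum-minTurnGo s zero zero {j = zero} refl _ z≤n = sym (cong (_* 1) (*-zeroʳ k))
  pathSum-minTurnGo s zero (suc h) {c = c} {zero} refl c≡s z≤n = begin
    pathSum (suc h) (suc h) (minTurnGo k s (suc h) c) + downsBefore 0 (suc h) 0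
      ≡⟨ cong (_+ downsBefore 0 (suc h) 0) (pathSum-suc-suc h h _) ⟩
    (u + p) + downsBefore 0 (suc h) 0
      ≡⟨ cong₂ _+_ (cong (_+ p) (pathSum-vanish h (suc h + k) _ (s≤s (m≤m+n h k)))) (downsBefore-zero-suc h 0) ⟩
    p + (downsBefore 0 h 0 + 1)
      ≡⟨ sym (+-assoc p _ 1) ⟩
    (p + downsBefore 0 h 0) + 1
      ≡⟨ cong (_+ 1) (pathSum-minTurnGo s zero h refl c≡s z≤n) ⟩
    (h + k * 0) * 1 + 1
      ≡⟨ step k h ⟩
    (suc h + k * 0) * 1
      ∎
    where
      u p : ℕ
      u = pathSum (suc h + k) h (λ w → minTurnGo k s (suc h) c (U ∷ w))
      p = pathSum h h (minTurnGo k s h c)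
      step : ∀ k h → (h + k * 0) * 1 + 1 ≡ (suc h + k * 0) * 1
      step = solve-∀
  pathSum-minTurnGo s (suc n) h {zero} ()
  pathSum-minTurnGo s (suc n) zero {suc L} {c} {zero} eq c≡s _ = begin
    pathSum 0 (suc L) (minTurnGo k s 0 c) + 0
      ≡⟨ trans (+-identityʳ _) (pathSum-zero-suc L _) ⟩
    pathSum k L (λ w → minTurnGo k s 0 c (U ∷ w))
      ≡⟨ pathSum-cong k L (λ w → minTurnGo-U-stop k 0 w c≡s) ⟩
    pathSum k L (λ _ → 0)
      ≡⟨ pathSum-const 0 n k (length-U n 0 eq) ⟩
    0
      ≡⟨ sym (cong (_* dyckFrom k n) (*-zeroʳ k)) ⟩
    k * 0 * dyckFrom k n
      ∎
  pathSum-minTurnGo s (suc n) zero {suc L} {c} {suc j} eq j+c≡s (s≤s j≤n) = begin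
    pathSum 0 (suc L) (minTurnGo k s 0 c) + downsBefore (suc j) 0 (suc n)
      ≡⟨ cong₂ _+_ (trans (pathSum-zero-suc L _)
                          (pathSum-cong k L (λ w → minTurnGo-U-pass k 0 w ([1+j]+c≡s⇒c≢s j j+c≡s))))
                   (downsBefore-suc-zero j n) ⟩
    pathSum k L (minTurnGo k s k (suc c)) + downsBefore j k n
      ≡⟨ pathSum-minTurnGo s n k (length-U n 0 eq) (trans (+-suc j c) j+c≡s) j≤n ⟩
    (k + k * j) * dyckFrom k n
      ≡⟨ cong (_* dyckFrom k n) (sym (*-suc k j)) ⟩
    k * suc j * dyckFrom k n
      ∎
  pathSum-minTurnGo s (suc n) (suc h) {suc L} {c} {zero} eq c≡s _ = begin
    pathSum (suc h) (suc L) (minTurnGo k s (suc h) c) + downsBefore 0 (suc h) (suc n)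
      ≡⟨ cong (_+ downsBefore 0 (suc h) (suc n)) (pathSum-suc-suc h L _) ⟩
    (u + p) + downsBefore 0 (suc h) (suc n)
      ≡⟨ cong₂ _+_ (cong (_+ p) up-step) (downsBefore-zero-suc h (suc n)) ⟩
    (suc h * d′ + p) + (downsBefore 0 h (suc n) + d)
      ≡⟨ regroup (suc h * d′) p _ d ⟩
    suc h * d′ + (p + downsBefore 0 h (suc n)) + d
      ≡⟨ cong (λ x → suc h * d′ + x + d) (pathSum-minTurnGo s (suc n) h (length-D (suc n) h eq) c≡s z≤n) ⟩
    suc h * d′ + (h + k * 0) * d + d
      ≡⟨ collect k h d d′ ⟩
    (suc h + k * 0) * (d + d′)
      ∎
    where
      u p d d′ : ℕ
      u = pathSum (suc h + k) L (λ w → minTurnGo k s (suc h) c (U ∷ w))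
      p = pathSum h L (minTurnGo k s h c)
      d = dyckFrom h (suc n)
      d′ = dyckFrom (suc h + k) n
      up-step : u ≡ suc h * d′
      up-step = trans (pathSum-cong (suc h + k) L (λ w → minTurnGo-U-stop k (suc h) w c≡s))
                      (pathSum-const (suc h) n (suc h + k) (length-U n (suc h) eq))
      regroup : ∀ a p q d → (a + p) + (q + d) ≡ a + (p + q) + d
      regroup = solve-∀
      collect : ∀ k h d d′ → suc h * d′ + (h + k * 0) * d + d ≡ (suc h + k * 0) * (d + d′)
      collect = solve-∀
  pathSum-minTurnGo s (suc n) (suc h) {suc L} {c} {suc j} eq j+c≡s (s≤s j≤n) = begin
    pathSum (suc h) (suc L) (minTurnGo k s (suc h) c) + downsBefore (suc j) (suc h) (suc n)
      ≡⟨ cong (_+ downsBefore (suc j) (suc h) (suc n)) (pathSum-suc-suc h L _) ⟩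
    (u + p) + downsBefore (suc j) (suc h) (suc n)
      ≡⟨ cong₂ _+_ (cong (_+ p) up-step) (downsBefore-suc-suc j h n) ⟩
    (u′ + p) + (q + q′ + d)
      ≡⟨ regroup u′ p q q′ d ⟩
    (u′ + q′) + (p + q) + d
      ≡⟨ cong₂ (λ x y → x + y + d)
               (pathSum-minTurnGo s n (suc h + k) (length-U n (suc h) eq) (trans (+-suc j c) j+c≡s) j≤n)
               (pathSum-minTurnGo s (suc n) h (length-D (suc n) h eq) j+c≡s (s≤s j≤n)) ⟩
    (suc h + k + k * j) * d′ + (h + k * suc j) * d + d
      ≡⟨ collect k h j d d′ ⟩
    (suc h + k * suc j) * (d + d′)
      ∎
    where
      u u′ p q q′ d d′ : ℕ
      u = pathSum (suc h + k) L (λ w → minTurnGo k s (suc h) c (U ∷ w))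
      u′ = pathSum (suc h + k) L (minTurnGo k s (suc h + k) (suc c))
      p = pathSum h L (minTurnGo k s h c)
      q = downsBefore (suc j) h (suc n)
      q′ = downsBefore j (suc h + k) n
      d = dyckFrom h (suc n)
      d′ = dyckFrom (suc h + k) n
      up-step : u ≡ u′
      up-step = pathSum-cong (suc h + k) L (λ w → minTurnGo-U-pass k (suc h) w ([1+j]+c≡s⇒c≢s j j+c≡s))
      regroup : ∀ u p q q′ d → (u + p) + (q + q′ + d) ≡ (u + q′) + (p + q) + d
      regroup = solve-∀
      collect : ∀ k h j d d′ → (suc h + k + k * j) * d′ + (h + k * suc j) * d + d ≡ (suc h + k * suc j) * (d + d′)
      collect = solve-∀

  totalMinTurnLevel≡pathSum : ∀ N s → totalMinTurnLevel k N s ≡ pathSum 0 (suc k * N) (minTurnGo k s 0 0)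
  totalMinTurnLevel≡pathSum N s =
    trans (sum-map-filterᵇ (isDyckᵇ k) (minTurnLevel k s) (words (suc k * N)))
          (cong sum (map-cong (λ w → cong (λ b → if b then minTurnGo k s 0 0 w else 0) (isDyckᵇ≡isZeroᵇ k w))
                              (words (suc k * N))))

  downsBefore-zero : ∀ s N →
    downsBefore s 0 N ≡ ∑[ l < s ] ((s ∸ l) * (dyckFrom 0 (suc l) * dyckBelow k (N ∸ suc l)))
  downsBefore-zero s N = trans (∑-cong (suc s) (λ i → +-identityʳ (∑< i f))) (∑-triangle s f)
    where
      f : ℕ → ℕ
      f l = dyckFrom 0 (suc l) * dyckBelow k (N ∸ suc l)

  totalMinTurnLevel-+ : ∀ N s → s ≤ N →
    totalMinTurnLevel k N s + ∑[ l < s ] ((s ∸ l) * (dyckFrom 0 (suc l) * dyckBelow k (N ∸ suc l)))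
      ≡ k * s * dyckFrom 0 N
  totalMinTurnLevel-+ N s s≤N = begin
    totalMinTurnLevel k N s + ∑[ l < s ] ((s ∸ l) * (dyckFrom 0 (suc l) * dyckBelow k (N ∸ suc l)))
      ≡⟨ cong₂ _+_ (totalMinTurnLevel≡pathSum N s) (sym (downsBefore-zero s N)) ⟩
    pathSum 0 (suc k * N) (minTurnGo k s 0 0) + downsBefore s 0 N
      ≡⟨ pathSum-minTurnGo s N 0 (trans (*-comm (suc k) N) (sym (+-identityʳ _))) (+-identityʳ s) s≤N ⟩
    k * s * dyckFrom 0 N
      ∎

rhsTerm≡ℕ→ℚ : ∀ k N s l → rhsTerm k N s (suc l)
  ≡ ℕ→ℚ ((s ∸ l) * (dyckFrom k 0 (suc l) * dyckBelow k k (N ∸ suc l)))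
rhsTerm≡ℕ→ℚ k N s l = begin
  ℕ→ℚ (s ∸ l) ℚ.* _ ℚ.* _
    ≡⟨ cong₂ (λ x y → ℕ→ℚ (s ∸ l) ℚ.* x ℚ.* y)
             (/-suc≡ℕ→ℚ a (k * suc l) (dyckFrom-zero-closed k (suc l)))
             (/-suc≡ℕ→ℚ b (N ∸ suc l) (dyckBelow-k-closed k (N ∸ suc l))) ⟩
  ℕ→ℚ (s ∸ l) ℚ.* ℕ→ℚ a ℚ.* ℕ→ℚ b
    ≡⟨ cong (ℚ._* ℕ→ℚ b) (ℕ→ℚ-* (s ∸ l) a) ⟨
  ℕ→ℚ ((s ∸ l) * a) ℚ.* ℕ→ℚ b
    ≡⟨ ℕ→ℚ-* ((s ∸ l) * a) b ⟨
  ℕ→ℚ ((s ∸ l) * a * b)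
    ≡⟨ cong ℕ→ℚ (*-assoc (s ∸ l) a b) ⟩
  ℕ→ℚ ((s ∸ l) * (a * b))
    ∎
  where
    a b : ℕ
    a = dyckFrom k 0 (suc l)
    b = dyckBelow k k (N ∸ suc l)

mainTheorem2 : (k N s : ℕ) → 1 ≤ k → 1 ≤ s → s ≤ N →
    ℕ→ℚ (totalMinTurnLevel k N s) ≡ rhs k N s
mainTheorem2 k N s _ _ s≤N = begin
  ℕ→ℚ (totalMinTurnLevel k N s)
    ≡⟨ ℕ→ℚ-difference (totalMinTurnLevel k N s) (∑[ l < s ] term l) (totalMinTurnLevel-+ k N s s≤N) ⟩
  ℕ→ℚ (k * s * dyckFrom k 0 N) ℚ.- ℕ→ℚ (∑[ l < s ] term l)
    ≡⟨ cong₂ ℚ._-_ leading (sumℚ-map-applyUpTo (rhsTerm≡ℕ→ℚ k N s) s (λ l → l)) ⟨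
  rhs k N s
    ∎
  where
    term : ℕ → ℕ
    term l = (s ∸ l) * (dyckFrom k 0 (suc l) * dyckBelow k k (N ∸ suc l))
    reorder : ∀ k s d q → k * s * d * q ≡ s * k * (d * q)
    reorder = solve-∀
    leading : (ℤ.+ (s * k * ((suc k * N) C N))) ℚ./ suc (k * N) ≡ ℕ→ℚ (k * s * dyckFrom k 0 N)
    leading = /-suc≡ℕ→ℚ (k * s * dyckFrom k 0 N) (k * N)
      (trans (reorder k s (dyckFrom k 0 N) (suc (k * N))) (cong (s * k *_) (dyckFrom-zero-closed k N)))
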